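{- Let $G$ be a simple, undirected, finite graph with adjacency matrix $A(G)$ (an $n\times n$ matrix with respect to some ordering of the vertices). Then there exists a $2n\times 2n$ permutation matrix $P$ with \[P^{ -1}\begin{pmatrix} A(G) & \mathbf{0}\\ \mathbf{0} & A(G)\end{pmatrix}P=\begin{pmatrix} \mathbf{0} & A(G)\\ A(G) & \mathbf{0}\end{pmatrix}\] if and only if $G$ is bipartite.
   Context: $\mathbf{0}$ denotes the $n\times n$ zero matrix. The adjacency matrix $A(G)=(a_{ij})$ has $a_{ij}=1$ if the $i$-th and $j$-th vertices are adjacent and $0$ otherwise. -}

module Defs where

open import Data.Nat using (ℕ; zero; suc; _+_; _*_)
open import Data.Fin using (Fin; splitAt)
open import Data.Fin.Properties using (_≟_)
open import Data.Bool using (Bool; true; false; if_then_else_)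
open import Data.Sum using (_⊎_; inj₁; inj₂)
open import Data.Product using (Σ; ∃; _×_; _,_)
open import Data.Vec.Functional using (foldr)
open import Function.Bundles using (_↔_; Inverse)
open import Relation.Nullary using (¬_; does)
open import Relation.Binary.PropositionalEquality using (_≡_)

-- A finite simple undirected graph on the vertex set Fin n (a fixed ordering
-- of the vertices): a Bool-valued adjacency relation that is symmetric and
-- irreflexive (no loops; simple = no multiple edges automatically).
record Graph (n : ℕ) : Set where
  field
    adj     : Fin n → Fin n → Bool
    symm    : ∀ i j → adj i j ≡ adj j i
    irrefl  : ∀ i → adj i i ≡ false
open Graph public

Matrix : ℕ → Set
Matrix m = Fin m → Fin m → ℕ

A : ∀ {n} → Graph n → Matrix n
A G i j = if adj G i j then 1 else 0

zeroM : ∀ {n} → Matrix n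
zeroM _ _ = 0

block : ∀ {n} → Matrix n → Matrix n → Matrix n → Matrix n → Matrix (n + n)
block {n} M11 M12 M21 M22 i j with splitAt n i | splitAt n j
... | inj₁ a | inj₁ b = M11 a b
... | inj₁ a | inj₂ b = M12 a b
... | inj₂ a | inj₁ b = M21 a b
... | inj₂ a | inj₂ b = M22 a b

_⊗_ : ∀ {m} → Matrix m → Matrix m → Matrix m
(M ⊗ N) i k = foldr _+_ 0 (λ j → M i j * N j k)

identity : ∀ {m} → Matrix m
identity i j = if does (i ≟ j) then 1 else 0

IsPermutationMatrix : ∀ {m} → Matrix m → Set
IsPermutationMatrix {m} P =
  Σ (Fin m ↔ Fin m) λ σ → ∀ i j → P i j ≡ (if does (Inverse.to σ i ≟ j) then 1 else 0)

IsInverse : ∀ {m} → Matrix m → Matrix m → Set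
IsInverse Q P = (∀ i j → (Q ⊗ P) i j ≡ identity i j) × (∀ i j → (P ⊗ Q) i j ≡ identity i j)

IsBipartite : ∀ {n} → Graph n → Set
IsBipartite {n} G = ∃ λ (c : Fin n → Bool) → ∀ i j → adj G i j ≡ true → ¬ (c i ≡ c j)

-- Conjugating by a permutation matrix only relabels rows and columns, so the two block matrices
-- are permutation-similar exactly when a bijection of the 2n indices carries the adjacency
-- matrix of two disjoint copies of G onto that of its bipartite double cover.  Writing an index
-- as a vertex together with its block (a Bool, so that "same block" becomes a xor), a proper
-- 2-colouring c yields such a bijection: swap the two copies of every vertex of colour true.
-- Conversely, colour each vertex by the block into which the bijection sends its first copy;
-- an edge inside one colour class would then be an edge of the double cover inside one block.
module Submission where

open import Defs
open import Algebra using (CommutativeRing)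
open import Data.Bool using (Bool; true; false; not; _xor_; if_then_else_)
open import Data.Bool.Properties
  using (xor-∧-commutativeRing; xor-assoc; xor-comm; xor-same; xor-identityʳ; xor-inverseˡ; ¬-not; if-not; if-eta)
open import Data.Fin using (Fin; zero; suc; splitAt; _↑ˡ_; _↑ʳ_)
open import Data.Fin.Properties using (_≟_; splitAt-↑ˡ; splitAt-↑ʳ; splitAt⁻¹-↑ˡ; splitAt⁻¹-↑ʳ)
open import Data.Nat using (ℕ; _+_; _*_)
open import Data.Nat.Properties using (+-identityʳ; *-identityʳ; *-zeroʳ)
open import Data.Product using (Σ; ∃; _×_; _,_)
open import Data.Sum using ([_,_]′; inj₁; inj₂)
open import Data.Vec.Functional using (foldr)
open import Data.Vec.Functional.Relation.Binary.Pointwise.Properties using (foldr-cong)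
open import Function using (id; const; _∘_)
open import Function.Bundles using (_⇔_; mk⇔; _↔_; Inverse; mk↔ₛ′)
open import Function.Construct.Composition using (_⇔-∘_)
open import Relation.Nullary using (¬_; yes; no; contradiction)
open import Relation.Binary.PropositionalEquality
open ≡-Reasoning
open import Algebra.Properties.CommutativeSemigroup
  (CommutativeRing.+-commutativeSemigroup xor-∧-commutativeRing) using (interchange)

open Inverse using (to; from; strictlyInverseˡ; strictlyInverseʳ)

sum : ∀ {m} → (Fin m → ℕ) → ℕ
sum = foldr _+_ 0

sum-cong : ∀ {m} {f g : Fin m → ℕ} → (∀ k → f k ≡ g k) → sum f ≡ sum g
sum-cong = foldr-cong {R = _≡_} {S = _≡_} (cong₂ _+_) refl

sum-zero : ∀ m → sum (const {B = Fin m} 0) ≡ 0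
sum-zero ℕ.zero = refl
sum-zero (ℕ.suc m) = sum-zero m

sum-identityˡ : ∀ {m} (i : Fin m) (f : Fin m → ℕ) → sum (λ k → identity i k * f k) ≡ f i
sum-identityˡ {ℕ.suc m} zero f = trans (cong₂ _+_ (+-identityʳ (f zero)) (sum-zero m)) (+-identityʳ (f zero))
sum-identityˡ (suc i) f = sum-identityˡ i (f ∘ suc)

sum-identityʳ : ∀ {m} (j : Fin m) (f : Fin m → ℕ) → sum (λ k → f k * identity k j) ≡ f j
sum-identityʳ {ℕ.suc m} zero f = begin
  f zero * 1 + sum {m} (λ k → f (suc k) * 0) ≡⟨ cong₂ _+_ (*-identityʳ (f zero)) (sum-cong (*-zeroʳ ∘ f ∘ suc)) ⟩
  f zero + sum {m} (const 0)                 ≡⟨ cong (f zero +_) (sum-zero m) ⟩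
  f zero + 0                                 ≡⟨ +-identityʳ (f zero) ⟩
  f zero                                     ∎
sum-identityʳ (suc j) f =
  trans (cong (_+ sum (λ k → f (suc k) * identity k j)) (*-zeroʳ (f zero))) (sum-identityʳ j (f ∘ suc))

identity-↔ : ∀ {m k} (σ : Fin m ↔ Fin k) i j → identity (to σ i) j ≡ identity i (from σ j)
identity-↔ σ i j with to σ i ≟ j | i ≟ from σ j
... | yes _  | yes _  = refl
... | no  _  | no  _  = refl
... | yes eq | no ne  = contradiction (sym (Inverse.inverseʳ σ (sym eq))) ne
... | no ne  | yes eq = contradiction (Inverse.inverseˡ σ eq) ne

⊗-unitRow : ∀ {m} (R : Matrix m) {x i} → (∀ k → R x k ≡ identity i k) → ∀ M j → (R ⊗ M) x j ≡ M i j
⊗-unitRow R {i = i} row M j = trans (sum-cong (λ k → cong (_* M k j) (row k))) (sum-identityˡ i (λ k → M k j))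

⊗-unitColumn : ∀ {m} (C : Matrix m) {y j} → (∀ k → C k y ≡ identity k j) → ∀ M x → (M ⊗ C) x y ≡ M x j
⊗-unitColumn C {j = j} column M x = trans (sum-cong (λ k → cong (M x k *_) (column k))) (sum-identityʳ j (M x))

permutation-⊗ : ∀ {m} {P : Matrix m} (σ : Fin m ↔ Fin m) → (∀ i j → P i j ≡ identity (to σ i) j) →
                ∀ M i j → (P ⊗ M) i j ≡ M (to σ i) j
permutation-⊗ {P = P} σ hP M i = ⊗-unitRow P (hP i) M

⊗-permutation : ∀ {m} {P : Matrix m} (σ : Fin m ↔ Fin m) → (∀ i j → P i j ≡ identity (to σ i) j) →
                ∀ M i j → (M ⊗ P) i j ≡ M i (from σ j)
⊗-permutation {P = P} σ hP M i j = ⊗-unitColumn P (λ k → trans (hP k j) (identity-↔ σ k j)) M i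

PermutationSimilar : ∀ {m} → Matrix m → Matrix m → Set
PermutationSimilar {m} M N =
  Σ (Matrix m) λ P → IsPermutationMatrix P × Σ (Matrix m) λ Pinv → IsInverse Pinv P ×
    (∀ i j → ((Pinv ⊗ M) ⊗ P) i j ≡ N i j)

Relabels : ∀ {m} → Fin m ↔ Fin m → Matrix m → Matrix m → Set
Relabels σ M N = ∀ i j → N (to σ i) (to σ j) ≡ M i j

similar⇒relabels : ∀ {m} {M N : Matrix m} → PermutationSimilar M N → ∃ λ σ → Relabels σ M N
similar⇒relabels {M = M} {N} (P , (σ , hP) , Q , (_ , PQ≡I) , conj) = σ , relabel
  where
  relabel : Relabels σ M N
  relabel i j = begin
    N (to σ i) (to σ j)                 ≡⟨ conj (to σ i) (to σ j) ⟨
    ((Q ⊗ M) ⊗ P) (to σ i) (to σ j)     ≡⟨ ⊗-permutation σ hP (Q ⊗ M) (to σ i) (to σ j) ⟩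
    (Q ⊗ M) (to σ i) (from σ (to σ j))  ≡⟨ cong ((Q ⊗ M) (to σ i)) (strictlyInverseʳ σ j) ⟩
    (Q ⊗ M) (to σ i) j                  ≡⟨ ⊗-unitRow Q (λ k → trans (sym (permutation-⊗ σ hP Q i k)) (PQ≡I i k)) M j ⟩
    M i j                               ∎

relabels⇒similar : ∀ {m} {M N : Matrix m} → (∃ λ σ → Relabels σ M N) → PermutationSimilar M N
relabels⇒similar {m} {M} {N} (σ , relabel) = P , (σ , λ _ _ → refl) , Q , (QP≡I , PQ≡I) , conj
  where
  P Q : Matrix m
  P i j = identity (to σ i) j
  Q i j = identity (from σ i) j

  QP≡I : ∀ i j → (Q ⊗ P) i j ≡ identity i j
  QP≡I i j = trans (⊗-unitRow Q (λ _ → refl) P j) (cong (λ x → identity x j) (strictlyInverseˡ σ i))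

  PQ≡I : ∀ i j → (P ⊗ Q) i j ≡ identity i j
  PQ≡I i j = trans (⊗-unitRow P (λ _ → refl) Q j) (cong (λ x → identity x j) (strictlyInverseʳ σ i))

  conj : ∀ i j → ((Q ⊗ M) ⊗ P) i j ≡ N i j
  conj i j = begin
    ((Q ⊗ M) ⊗ P) i j                      ≡⟨ ⊗-permutation σ (λ _ _ → refl) (Q ⊗ M) i j ⟩
    (Q ⊗ M) i (from σ j)                   ≡⟨ ⊗-unitRow Q (λ _ → refl) M (from σ j) ⟩
    M (from σ i) (from σ j)                ≡⟨ relabel (from σ i) (from σ j) ⟨
    N (to σ (from σ i)) (to σ (from σ j))  ≡⟨ cong₂ N (strictlyInverseˡ σ i) (strictlyInverseˡ σ j) ⟩
    N i j                                  ∎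

similar⇔relabelling : ∀ {m} {M N : Matrix m} → PermutationSimilar M N ⇔ (∃ λ σ → Relabels σ M N)
similar⇔relabelling = mk⇔ similar⇒relabels relabels⇒similar

xor-cancelʳ : ∀ a b → (a xor b) xor b ≡ a
xor-cancelʳ a b = trans (xor-assoc a b b) (trans (cong (a xor_) (xor-same b)) (xor-identityʳ a))

xor-≢ : ∀ {a b} → ¬ a ≡ b → a xor b ≡ true
xor-≢ {b = b} a≢b = trans (cong (_xor b) (¬-not a≢b)) (xor-inverseˡ b)

xor-xor-complement : ∀ a b p q → p xor q ≡ true → (a xor p) xor (b xor q) ≡ not (a xor b)
xor-xor-complement a b p q p⊕q = begin
  (a xor p) xor (b xor q)  ≡⟨ interchange a p b q ⟩
  (a xor b) xor (p xor q)  ≡⟨ cong ((a xor b) xor_) p⊕q ⟩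
  (a xor b) xor true       ≡⟨ xor-comm (a xor b) true ⟩
  not (a xor b)            ∎

module TwoCopies (n : ℕ) where

  side : Fin (n + n) → Bool
  side x = [ const false , const true ]′ (splitAt n x)

  vertex : Fin (n + n) → Fin n
  vertex x = [ id , id ]′ (splitAt n x)

  copy : Bool → Fin n → Fin (n + n)
  copy false u = u ↑ˡ n
  copy true  u = n ↑ʳ u

  side-copy : ∀ b u → side (copy b u) ≡ b
  side-copy false u = cong [ const false , const true ]′ (splitAt-↑ˡ n u n)
  side-copy true  u = cong [ const false , const true ]′ (splitAt-↑ʳ n n u)

  vertex-copy : ∀ b u → vertex (copy b u) ≡ u
  vertex-copy false u = cong [ id , id ]′ (splitAt-↑ˡ n u n)
  vertex-copy true  u = cong [ id , id ]′ (splitAt-↑ʳ n n u)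

  copy-side-vertex : ∀ x → copy (side x) (vertex x) ≡ x
  copy-side-vertex x with splitAt n x in eq
  ... | inj₁ u = splitAt⁻¹-↑ˡ eq
  ... | inj₂ u = splitAt⁻¹-↑ʳ eq

  block-copy : ∀ (D O : Matrix n) a b u v →
               block D O O D (copy a u) (copy b v) ≡ (if a xor b then O u v else D u v)
  block-copy D O false false u v rewrite splitAt-↑ˡ n u n | splitAt-↑ˡ n v n = refl
  block-copy D O false true  u v rewrite splitAt-↑ˡ n u n | splitAt-↑ʳ n n v = refl
  block-copy D O true  false u v rewrite splitAt-↑ʳ n n u | splitAt-↑ˡ n v n = refl
  block-copy D O true  true  u v rewrite splitAt-↑ʳ n n u | splitAt-↑ʳ n n v = refl

  block-side : ∀ (D O : Matrix n) x y →
               block D O O D x y ≡ (if side x xor side y then O (vertex x) (vertex y) else D (vertex x) (vertex y))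
  block-side D O x y = begin
    block D O O D x y
      ≡⟨ cong₂ (block D O O D) (copy-side-vertex x) (copy-side-vertex y) ⟨
    block D O O D (copy (side x) (vertex x)) (copy (side y) (vertex y))
      ≡⟨ block-copy D O (side x) (side y) (vertex x) (vertex y) ⟩
    (if side x xor side y then O (vertex x) (vertex y) else D (vertex x) (vertex y)) ∎

  block-sameSide : ∀ (D O : Matrix n) {x y} → side x ≡ side y → block D O O D x y ≡ D (vertex x) (vertex y)
  block-sameSide D O {x} {y} same = trans (block-side D O x y)
    (cong (λ b → if b then O (vertex x) (vertex y) else D (vertex x) (vertex y))
          (trans (cong (_xor side y) same) (xor-same (side y))))

  swapCopies : (Fin n → Bool) → Fin (n + n) → Fin (n + n)
  swapCopies c x = copy (side x xor c (vertex x)) (vertex x)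

  swapCopies-involutive : ∀ c x → swapCopies c (swapCopies c x) ≡ x
  swapCopies-involutive c x = begin
    swapCopies c (copy (side x xor c u) u)
      ≡⟨ cong₂ (λ b w → copy (b xor c w) w) (side-copy (side x xor c u) u) (vertex-copy (side x xor c u) u) ⟩
    copy ((side x xor c u) xor c u) u       ≡⟨ cong (λ b → copy b u) (xor-cancelʳ (side x) (c u)) ⟩
    copy (side x) u                         ≡⟨ copy-side-vertex x ⟩
    x                                       ∎
    where u = vertex x

  swapCopies↔ : (Fin n → Bool) → Fin (n + n) ↔ Fin (n + n)
  swapCopies↔ c = mk↔ₛ′ (swapCopies c) (swapCopies c) (swapCopies-involutive c) (swapCopies-involutive c)

module _ {n : ℕ} (G : Graph n) where

  open TwoCopies n

  A-adjacent : ∀ {u v} → adj G u v ≡ true → A G u v ≡ 1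
  A-adjacent e = cong (λ b → if b then 1 else 0) e

  swapCopies-relabels : ∀ (c : Fin n → Bool) → (∀ u v → adj G u v ≡ true → ¬ c u ≡ c v) →
    Relabels (swapCopies↔ c) (block (A G) zeroM zeroM (A G)) (block zeroM (A G) (A G) zeroM)
  swapCopies-relabels c proper x y = begin
    block zeroM (A G) (A G) zeroM (swapCopies c x) (swapCopies c y)
      ≡⟨ block-copy zeroM (A G) (side x xor c u) (side y xor c v) u v ⟩
    (if (side x xor c u) xor (side y xor c v) then A G u v else 0)
      ≡⟨ entry (side x) (side y) ⟩
    (if side x xor side y then 0 else A G u v)
      ≡⟨ block-side (A G) zeroM x y ⟨
    block (A G) zeroM zeroM (A G) x y ∎
    where
    u = vertex x
    v = vertex y
    entry : ∀ a b → (if (a xor c u) xor (b xor c v) then A G u v else 0) ≡ (if a xor b then 0 else A G u v)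
    entry a b with adj G u v in e
    ... | false = trans (if-eta ((a xor c u) xor (b xor c v))) (sym (if-eta (a xor b)))
    ... | true  = trans (cong (λ s → if s then 1 else 0) (xor-xor-complement a b (c u) (c v) (xor-≢ (proper u v e))))
                        (if-not (a xor b))

  relabels⇒bipartite : (∃ λ σ → Relabels σ (block (A G) zeroM zeroM (A G)) (block zeroM (A G) (A G) zeroM)) →
                       IsBipartite G
  relabels⇒bipartite (σ , relabel) = colour , proper
    where
    colour : Fin n → Bool
    colour u = side (to σ (copy false u))
    proper : ∀ u v → adj G u v ≡ true → ¬ colour u ≡ colour v
    proper u v e same = contradiction (begin
      1
        ≡⟨ A-adjacent e ⟨
      A G u v
        ≡⟨ block-copy (A G) zeroM false false u v ⟨
      block (A G) zeroM zeroM (A G) (copy false u) (copy false v)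
        ≡⟨ relabel (copy false u) (copy false v) ⟨
      block zeroM (A G) (A G) zeroM (to σ (copy false u)) (to σ (copy false v))
        ≡⟨ block-sameSide zeroM (A G) same ⟩
      0 ∎) λ ()

  relabelling⇔bipartite :
    (∃ λ σ → Relabels σ (block (A G) zeroM zeroM (A G)) (block zeroM (A G) (A G) zeroM)) ⇔ IsBipartite G
  relabelling⇔bipartite = mk⇔ relabels⇒bipartite
    λ (c , proper) → swapCopies↔ c , swapCopies-relabels c proper

mainTheorem6 : ∀ (n : ℕ) (G : Graph n) →
    (Σ (Matrix (n + n)) λ P → IsPermutationMatrix P × Σ (Matrix (n + n)) λ Pinv → IsInverse Pinv P ×
    (∀ i j → ((Pinv ⊗ block (A G) zeroM zeroM (A G)) ⊗ P) i j ≡ block zeroM (A G) (A G) zeroM i j))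
    ⇔ IsBipartite G
mainTheorem6 n G = relabelling⇔bipartite G ⇔-∘ similar⇔relabelling
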